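{- For all $n,k\ge0$, $\Xi(\mathfrak B_{n,k})=\mathtt{MB}_{n,k}$.
   Context: $\mathbf{WSym}$ is the algebra with basis $(\Phi_\pi)$ indexed by set partitions $\pi$ of $\{1,\dots,n\}$, $n\ge0$ ($\Phi_\emptyset=1$), product $\Phi_\pi\Phi_{\pi'}=\Phi_{\pi\cup\pi'[n]}$ for $\pi$ a partition of $\{1,\dots,n\}$ ($\pi'[n]$ adds $n$ to each element of $\pi'$). Let $\partial:\mathbf{WSym}\to\mathbf{WSym}$ be linear with $\partial(1)=0$ and $\partial(\Phi_\pi)=\sum_{i=1}^k\Phi_{(\pi\setminus\{\pi_i\})\cup\{\pi_i\cup\{n+1\}\}}$ for $\pi=\{\pi_1,\dots,\pi_k\}$ a set partition of $\{1,\dots,n\}$; extend $t$-linearly, and let $\mathfrak B_{n,k}$ be the coefficient of $t^k$ in $T^n(1)$ where $T(x)=t\,x\,\Phi_{\{\{1\}\}}+\partial(x)$. Let $\mathbb D=\{d_1,d_2,\dots\}$ be an alphabet and $\partial_{\mathbb D}$ the derivation of $\mathbb C\langle\mathbb D\rangle$ (Leibniz rule, $\partial_{\mathbb D}(1)=0$) with $\partial_{\mathbb D}(d_i)=d_{i+1}$, extended $t$-linearly for a commuting indeterminate $t$. The Munthe-Kaas polynomials are $\mathtt{MB}_n(t)=R^n(1)$ where $R(x)=t\,x\,d_1+\partial_{\mathbb D}(x)$, and $\mathtt{MB}_{n,k}$ is the coefficient of $t^k$ in $\mathtt{MB}_n(t)$. For a set partition $\pi=\{\pi_1,\dots,\pi_k\}$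 indexed so that $\min\pi_1<\min\pi_2<\dots<\min\pi_k$, let $\chi(\pi)=[\#\pi_1,\dots,\#\pi_k]$, and let $\Xi:\mathbf{WSym}\to\mathbb C\langle\mathbb D\rangle$ be the linear map with $\Xi(\Phi_\pi)=d_{\#\pi_1}d_{\#\pi_2}\cdots d_{\#\pi_k}$. -}

module Defs where

open import Data.Nat using (ℕ; zero; suc; _+_; _*_)
open import Data.Nat.Properties using () renaming (_≟_ to _≟ℕ_)
open import Data.List using (List; []; _∷_; _++_; map; concatMap; length; sum; filter)
open import Data.List.Properties using (≡-dec)
open import Data.Product using (_×_; _,_; proj₁; proj₂)
open import Relation.Binary.PropositionalEquality using (_≡_)
open import Relation.Nullary using (Dec; yes; no)

-- Free ℕ-modules: a formal linear combination is a finite list of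
-- (coefficient , basis element) pairs.  (All objects in the statement
-- have nonnegative integer coefficients.)

FreeMod : Set → Set
FreeMod B = List (ℕ × B)

zeroM : ∀ {B} → FreeMod B
zeroM = []

_+M_ : ∀ {B} → FreeMod B → FreeMod B → FreeMod B
_+M_ = _++_

linExt : ∀ {A B} → (A → FreeMod B) → FreeMod A → FreeMod B
linExt f = concatMap (λ { (c , a) → map (λ { (d , b) → (c * d , b) }) (f a) })

bilinExt : ∀ {A B C} → (A → B → FreeMod C) → FreeMod A → FreeMod B → FreeMod C
bilinExt f x y = linExt (λ a → linExt (f a) y) x

-- A set partition of {1,…,n} is stored as the pair (n , blocks), where
-- blocks : List (List ℕ) lists the blocks, each block with its elements
-- in increasing order, and the blocks ordered by increasing minimum.
-- This is the canonical representative of the set partition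
-- {π₁,…,π_k} with min π₁ < … < min π_k (so each set partition has
-- exactly one representation).

SetPartition : Set
SetPartition = ℕ × List (List ℕ)

WSym : Set
WSym = FreeMod SetPartition

oneW : WSym
oneW = (1 , (0 , [])) ∷ []

Φ₁ : WSym
Φ₁ = (1 , (1 , (1 ∷ []) ∷ [])) ∷ []

-- Φ_π Φ_π' = Φ_{π ∪ π'[n]}  (shifting keeps the canonical ordering)
mulBasis : SetPartition → SetPartition → WSym
mulBasis (n , π) (m , π') = (1 , (n + m , π ++ map (map (n +_)) π')) ∷ []

_·W_ : WSym → WSym → WSym
_·W_ = bilinExt mulBasis

-- all ways of adding the element e to exactly one block
-- (appending at the end keeps blocks increasing since e is the largest)
addToOne : ℕ → List (List ℕ) → List (List (List ℕ))
addToOne e [] = []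
addToOne e (b ∷ bs) = ((b ++ (e ∷ [])) ∷ bs) ∷ map (b ∷_) (addToOne e bs)

∂Basis : SetPartition → WSym
∂Basis (n , π) = map (λ π' → (1 , (suc n , π'))) (addToOne (suc n) π)

∂W : WSym → WSym
∂W = linExt ∂Basis

-- Polynomials in a commuting indeterminate t with coefficients in a
-- free module: coefficient lists, index = power of t.

Poly : Set → Set
Poly B = List (FreeMod B)

_+P_ : ∀ {B} → Poly B → Poly B → Poly B
[] +P q = q
(x ∷ p) +P [] = x ∷ p
(x ∷ p) +P (y ∷ q) = (x +M y) ∷ (p +P q)

tP : ∀ {B} → Poly B → Poly B
tP p = zeroM ∷ p

coeffT : ∀ {B} → ℕ → Poly B → FreeMod B
coeffT k [] = zeroM
coeffT zero (x ∷ p) = x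
coeffT (suc k) (x ∷ p) = coeffT k p

iter : ∀ {A : Set} → ℕ → (A → A) → A → A
iter zero f a = a
iter (suc n) f a = f (iter n f a)

T : Poly SetPartition → Poly SetPartition
T p = tP (map (_·W Φ₁) p) +P map ∂W p

𝔅 : ℕ → ℕ → WSym
𝔅 n k = coeffT k (iter n T (oneW ∷ []))

-- ℂ⟨𝔻⟩: words in the letters d₁, d₂, …; the word d_{i₁}⋯d_{i_m} is the
-- list i₁ ∷ … ∷ i_m ∷ [] (indices ≥ 1).

Word : Set
Word = List ℕ

NC : Set
NC = FreeMod Word

oneD : NC
oneD = (1 , []) ∷ []

d₁ : NC
d₁ = (1 , (1 ∷ [])) ∷ []

_·D_ : NC → NC → NC
_·D_ = bilinExt (λ u v → (1 , u ++ v) ∷ [])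

-- the derivation ∂_𝔻 (Leibniz rule, ∂ d_i = d_{i+1}) on a word
∂Word : Word → NC
∂Word [] = []
∂Word (i ∷ w) = (1 , suc i ∷ w) ∷ map (λ { (c , v) → (c , i ∷ v) }) (∂Word w)

∂D : NC → NC
∂D = linExt ∂Word

R : Poly Word → Poly Word
R p = tP (map (_·D d₁) p) +P map ∂D p

MB : ℕ → ℕ → NC
MB n k = coeffT k (iter n R (oneD ∷ []))

-- χ(π) = [#π₁,…,#π_k]  (blocks already ordered by minima)
χ : SetPartition → List ℕ
χ (n , π) = map length π

Ξ : WSym → NC
Ξ = linExt (λ π → (1 , χ π) ∷ [])

coeffOf : Word → NC → ℕ
coeffOf w [] = 0
coeffOf w ((c , v) ∷ x) with ≡-dec _≟ℕ_ v w
... | yes _ = c + coeffOf w x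
... | no _ = coeffOf w x

_≈D_ : NC → NC → Set
x ≈D y = (w : Word) → coeffOf w x ≡ coeffOf w y

-- Ξ is a morphism of free modules that is multiplicative on Φ_{{1}} and intertwines ∂ with ∂_𝔻:
-- the blocks of a set partition are listed by increasing minima, so adding n+1 to the i-th block
-- raises the i-th letter of χ(π) by one, exactly as the Leibniz rule does on d_{#π₁}⋯d_{#π_k}.
-- Hence Ξ T = R Ξ coefficientwise in t, and iterating from Ξ(1) = 1 gives Ξ(𝔅_{n,k}) = MB_{n,k}.
module Submission where

open import Defs
open import Data.Nat using (ℕ; suc; _*_)
open import Data.Nat.Properties using (*-identityʳ; *-assoc; +-comm)
open import Data.List using (List; []; _∷_; _++_; map; length)
open import Data.List.Properties using (map-++; map-∘; map-cong; length-++; concatMap-++)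
open import Data.Product using (_,_)
open import Relation.Binary.PropositionalEquality
  using (_≡_; refl; sym; trans; cong; cong₂; module ≡-Reasoning)

open ≡-Reasoning

private
  variable
    A B A′ B′ : Set

-- Definitionally the scaling inside linExt, so linExt f ((c , a) ∷ x) reduces to scale c (f a) ++ linExt f x.
scale : ℕ → FreeMod B → FreeMod B
scale c = map (λ (d , b) → (c * d , b))

relabel : (A → B) → FreeMod A → FreeMod B
relabel σ = linExt (λ a → (1 , σ a) ∷ [])

linExt-++ : (f : A → FreeMod B) (x y : FreeMod A) → linExt f (x ++ y) ≡ linExt f x ++ linExt f y
linExt-++ f = concatMap-++ _

relabel-scale : (σ : A → B) (c : ℕ) (x : FreeMod A) → relabel σ (scale c x) ≡ scale c (relabel σ x)
relabel-scale σ c [] = refl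
relabel-scale σ c ((d , a) ∷ x) = cong₂ (λ e y → (e , σ a) ∷ y) (*-assoc c d 1) (relabel-scale σ c x)

relabel-map-unit : (σ : B → B′) (h : A → B) (l : List A) →
  relabel σ (map (λ a → (1 , h a)) l) ≡ map (λ a → (1 , σ (h a))) l
relabel-map-unit σ h [] = refl
relabel-map-unit σ h (a ∷ l) = cong (_ ∷_) (relabel-map-unit σ h l)

relabel-linExt : (σ : A → B) (σ′ : A′ → B′) (f : A → FreeMod A′) (g : B → FreeMod B′) →
  (∀ a → relabel σ′ (f a) ≡ g (σ a)) →
  ∀ x → relabel σ′ (linExt f x) ≡ linExt g (relabel σ x)
relabel-linExt σ σ′ f g fσ [] = refl
relabel-linExt σ σ′ f g fσ ((c , a) ∷ x) = begin
  relabel σ′ (scale c (f a) ++ linExt f x)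
    ≡⟨ linExt-++ (λ a′ → (1 , σ′ a′) ∷ []) (scale c (f a)) (linExt f x) ⟩
  relabel σ′ (scale c (f a)) ++ relabel σ′ (linExt f x)
    ≡⟨ cong₂ _++_ (relabel-scale σ′ c (f a)) (relabel-linExt σ σ′ f g fσ x) ⟩
  scale c (relabel σ′ (f a)) ++ linExt g (relabel σ x)
    ≡⟨ cong₂ (λ e y → scale e y ++ linExt g (relabel σ x)) (sym (*-identityʳ c)) (fσ a) ⟩
  scale (c * 1) (g (σ a)) ++ linExt g (relabel σ x)
    ∎

Ξ-·Φ₁ : (x : WSym) → Ξ (x ·W Φ₁) ≡ Ξ x ·D d₁
Ξ-·Φ₁ = relabel-linExt χ χ (λ a → linExt (mulBasis a) Φ₁) (λ u → linExt (λ v → (1 , u ++ v) ∷ []) d₁)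
  λ (n , π) → cong (λ w → (1 , w) ∷ []) (map-++ length π _)

∂Word-map-length : (e : ℕ) (π : List (List ℕ)) →
  ∂Word (map length π) ≡ map (λ π′ → (1 , map length π′)) (addToOne e π)
∂Word-map-length e [] = refl
∂Word-map-length e (b ∷ bs) = cong₂ (λ m y → (1 , m ∷ map length bs) ∷ y)
  (sym (trans (length-++ b) (+-comm (length b) 1)))
  (begin
    map (λ (c , v) → (c , length b ∷ v)) (∂Word (map length bs))
      ≡⟨ cong (map _) (∂Word-map-length e bs) ⟩
    map (λ (c , v) → (c , length b ∷ v)) (map (λ π′ → (1 , map length π′)) (addToOne e bs))
      ≡⟨ map-∘ (addToOne e bs) ⟨
    map (λ π′ → (1 , length b ∷ map length π′)) (addToOne e bs)
      ≡⟨ map-∘ (addToOne e bs) ⟩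
    map (λ π′ → (1 , map length π′)) (map (b ∷_) (addToOne e bs))
      ∎)

Ξ-∂W : (x : WSym) → Ξ (∂W x) ≡ ∂D (Ξ x)
Ξ-∂W = relabel-linExt χ χ ∂Basis ∂Word λ (n , π) →
  trans (relabel-map-unit χ (suc n ,_) (addToOne (suc n) π))
        (sym (∂Word-map-length (suc n) π))

map-+P : (f : FreeMod A → FreeMod B) → (∀ x y → f (x ++ y) ≡ f x ++ f y) →
  ∀ p q → map f (p +P q) ≡ map f p +P map f q
map-+P f f-++ [] q = refl
map-+P f f-++ (x ∷ p) [] = refl
map-+P f f-++ (x ∷ p) (y ∷ q) = cong₂ _∷_ (f-++ x y) (map-+P f f-++ p q)

map-Ξ-T : (p : Poly SetPartition) → map Ξ (T p) ≡ R (map Ξ p)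
map-Ξ-T p = begin
  map Ξ (tP (map (_·W Φ₁) p) +P map ∂W p)
    ≡⟨ map-+P Ξ (linExt-++ (λ π → (1 , χ π) ∷ [])) (tP (map (_·W Φ₁) p)) (map ∂W p) ⟩
  tP (map Ξ (map (_·W Φ₁) p)) +P map Ξ (map ∂W p)
    ≡⟨ cong₂ (λ u v → tP u +P v) (map-intertwine Ξ-·Φ₁ p) (map-intertwine Ξ-∂W p) ⟩
  tP (map (_·D d₁) (map Ξ p)) +P map ∂D (map Ξ p)
    ∎
  where
  map-intertwine : {g : WSym → WSym} {h : NC → NC} → (∀ x → Ξ (g x) ≡ h (Ξ x)) →
    ∀ l → map Ξ (map g l) ≡ map h (map Ξ l)
  map-intertwine Ξg≡hΞ l = trans (sym (map-∘ l)) (trans (map-cong Ξg≡hΞ l) (map-∘ l))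

coeffT-map : (f : FreeMod A → FreeMod B) → f zeroM ≡ zeroM →
  ∀ k p → f (coeffT k p) ≡ coeffT k (map f p)
coeffT-map f f0 k [] = f0
coeffT-map f f0 0 (x ∷ p) = refl
coeffT-map f f0 (suc k) (x ∷ p) = coeffT-map f f0 k p

iter-intertwine : (f : A → B) {g : A → A} {h : B → B} → (∀ x → f (g x) ≡ h (f x)) →
  ∀ n a → f (iter n g a) ≡ iter n h (f a)
iter-intertwine f fg≡hf 0 a = refl
iter-intertwine f {h = h} fg≡hf (suc n) a = trans (fg≡hf _) (cong h (iter-intertwine f fg≡hf n a))

mainTheorem14 : (n k : ℕ) → Ξ (𝔅 n k) ≈D MB n k
mainTheorem14 n k w = cong (coeffOf w) (begin
  Ξ (coeffT k (iter n T (oneW ∷ [])))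
    ≡⟨ coeffT-map Ξ refl k (iter n T (oneW ∷ [])) ⟩
  coeffT k (map Ξ (iter n T (oneW ∷ [])))
    ≡⟨ cong (coeffT k) (iter-intertwine (map Ξ) map-Ξ-T n (oneW ∷ [])) ⟩
  coeffT k (iter n R (oneD ∷ []))
    ∎)
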